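{- Let $\mathcal{C}$ be a gs-monoidal category. Then $\mathcal{C}$ is a Markov category if and only if it is a weakly Markov category and a mass category.
   Context: Composition is diagrammatic ($f;g$ means first $f$, then $g$); the right unitor is $\rho_X:X\to X\otimes I$. A gs-monoidal category is a symmetric monoidal category $(\mathcal{C},\otimes,I)$ with, for each object $X$, a discharger $!_X:X\to I$ and duplicator $\nabla_X:X\to X\otimes X$, compatible with the monoidal structure, with $\nabla_X$ coassociative, cocommutative, and $(X,\nabla_X,!_X)$ a comonoid. A Markov category is a gs-monoidal category in which every $f:X\to Y$ satisfies $f;!_Y=!_X$. $\mathcal{C}$ is weakly Markov if for every object $Y$ the commutative monoid $\mathcal{C}(Y,I)$ with multiplication $(f,g)\mapsto \nabla_Y;(f\otimes g);\rho^{ -1}_I$ and unit $!_Y$ is a group. For $f:X\to Y$, $\mathrm{mass}(f):=f;!_Y$ and $\mathrm{dom}(f):=\nabla_X;(\mathrm{id}_X\otimes(f;!_Y));\rho^{ -1}_X$; $\mathcal{C}$ is a mass category if $\mathrm{dom}(f);\mathrm{mass}(f)=\mathrm{mass}(f)$ for every arrow $f$. -}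

module Defs where

open import Level using (Level; suc; _⊔_)
open import Relation.Binary using (Rel; IsEquivalence)
open import Data.Product using (Σ; _×_)

-- Categories with hom-setoids; composition is DIAGRAMMATIC: f ⨾ g = first f, then g.
record Category (o ℓ e : Level) : Set (suc (o ⊔ ℓ ⊔ e)) where
  infixr 9 _⨾_
  infix  4 _≈_
  field
    Obj   : Set o
    _⇒_   : Obj → Obj → Set ℓ
    _≈_   : ∀ {A B} → Rel (A ⇒ B) e
    id    : ∀ {A} → A ⇒ A
    _⨾_   : ∀ {A B C} → A ⇒ B → B ⇒ C → A ⇒ C
    equiv     : ∀ {A B} → IsEquivalence (_≈_ {A} {B})
    ⨾-resp-≈  : ∀ {A B C} {f f′ : A ⇒ B} {g g′ : B ⇒ C} → f ≈ f′ → g ≈ g′ → f ⨾ g ≈ f′ ⨾ g′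
    identityˡ : ∀ {A B} {f : A ⇒ B} → id ⨾ f ≈ f
    identityʳ : ∀ {A B} {f : A ⇒ B} → f ⨾ id ≈ f
    assoc     : ∀ {A B C D} {f : A ⇒ B} {g : B ⇒ C} {h : C ⇒ D} → (f ⨾ g) ⨾ h ≈ f ⨾ (g ⨾ h)

record SymmetricMonoidalCategory (o ℓ e : Level) : Set (suc (o ⊔ ℓ ⊔ e)) where
  field
    category : Category o ℓ e
  open Category category public
  infixr 10 _⊗₀_ _⊗₁_
  field
    _⊗₀_ : Obj → Obj → Obj
    _⊗₁_ : ∀ {A B C D} → A ⇒ B → C ⇒ D → (A ⊗₀ C) ⇒ (B ⊗₀ D)
    unit : Obj
    ⊗-resp-≈ : ∀ {A B C D} {f f′ : A ⇒ B} {g g′ : C ⇒ D} → f ≈ f′ → g ≈ g′ → f ⊗₁ g ≈ f′ ⊗₁ g′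
    ⊗-id     : ∀ {A B} → id {A} ⊗₁ id {B} ≈ id
    ⊗-⨾      : ∀ {A B C D E F} {f : A ⇒ B} {g : B ⇒ C} {h : D ⇒ E} {k : E ⇒ F}
               → (f ⨾ g) ⊗₁ (h ⨾ k) ≈ (f ⊗₁ h) ⨾ (g ⊗₁ k)
    λ⇒ : ∀ X → X ⇒ (unit ⊗₀ X)
    λ⇐ : ∀ X → (unit ⊗₀ X) ⇒ X
    ρ⇒ : ∀ X → X ⇒ (X ⊗₀ unit)
    ρ⇐ : ∀ X → (X ⊗₀ unit) ⇒ X
    α⇒ : ∀ X Y Z → ((X ⊗₀ Y) ⊗₀ Z) ⇒ (X ⊗₀ (Y ⊗₀ Z))
    α⇐ : ∀ X Y Z → (X ⊗₀ (Y ⊗₀ Z)) ⇒ ((X ⊗₀ Y) ⊗₀ Z)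
    σ  : ∀ X Y → (X ⊗₀ Y) ⇒ (Y ⊗₀ X)
    λ-isoˡ : ∀ {X} → λ⇒ X ⨾ λ⇐ X ≈ id
    λ-isoʳ : ∀ {X} → λ⇐ X ⨾ λ⇒ X ≈ id
    ρ-isoˡ : ∀ {X} → ρ⇒ X ⨾ ρ⇐ X ≈ id
    ρ-isoʳ : ∀ {X} → ρ⇐ X ⨾ ρ⇒ X ≈ id
    α-isoˡ : ∀ {X Y Z} → α⇒ X Y Z ⨾ α⇐ X Y Z ≈ id
    α-isoʳ : ∀ {X Y Z} → α⇐ X Y Z ⨾ α⇒ X Y Z ≈ id
    σ-inv  : ∀ {X Y} → σ X Y ⨾ σ Y X ≈ id
    λ-natural : ∀ {X Y} {f : X ⇒ Y} → f ⨾ λ⇒ Y ≈ λ⇒ X ⨾ (id ⊗₁ f)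
    ρ-natural : ∀ {X Y} {f : X ⇒ Y} → f ⨾ ρ⇒ Y ≈ ρ⇒ X ⨾ (f ⊗₁ id)
    α-natural : ∀ {X X′ Y Y′ Z Z′} {f : X ⇒ X′} {g : Y ⇒ Y′} {h : Z ⇒ Z′}
                → ((f ⊗₁ g) ⊗₁ h) ⨾ α⇒ X′ Y′ Z′ ≈ α⇒ X Y Z ⨾ (f ⊗₁ (g ⊗₁ h))
    σ-natural : ∀ {X X′ Y Y′} {f : X ⇒ X′} {g : Y ⇒ Y′}
                → (f ⊗₁ g) ⨾ σ X′ Y′ ≈ σ X Y ⨾ (g ⊗₁ f)
    triangle : ∀ {X Y} → α⇒ X unit Y ⨾ (id ⊗₁ λ⇐ Y) ≈ ρ⇐ X ⊗₁ id
    pentagon : ∀ {W X Y Z}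
               → (α⇒ W X Y ⊗₁ id {Z}) ⨾ α⇒ W (X ⊗₀ Y) Z ⨾ (id {W} ⊗₁ α⇒ X Y Z)
                 ≈ α⇒ (W ⊗₀ X) Y Z ⨾ α⇒ W X (Y ⊗₀ Z)
    hexagon  : ∀ {X Y Z}
               → α⇒ X Y Z ⨾ σ X (Y ⊗₀ Z) ⨾ α⇒ Y Z X
                 ≈ (σ X Y ⊗₁ id {Z}) ⨾ α⇒ Y X Z ⨾ (id {Y} ⊗₁ σ X Z)

-- gs-monoidal categories: a commutative comonoid (∇ X, ! X) on every object,
-- compatible with the monoidal structure (NOT required to be natural).
record GSMonoidalCategory (o ℓ e : Level) : Set (suc (o ⊔ ℓ ⊔ e)) where
  field
    smc : SymmetricMonoidalCategory o ℓ e
  open SymmetricMonoidalCategory smc public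
  interchange : ∀ X Y → ((X ⊗₀ X) ⊗₀ (Y ⊗₀ Y)) ⇒ ((X ⊗₀ Y) ⊗₀ (X ⊗₀ Y))
  interchange X Y =
    α⇒ X X (Y ⊗₀ Y) ⨾ (id ⊗₁ (α⇐ X Y Y ⨾ (σ X Y ⊗₁ id) ⨾ α⇒ Y X Y)) ⨾ α⇐ X Y (X ⊗₀ Y)
  field
    !  : ∀ X → X ⇒ unit
    ∇  : ∀ X → X ⇒ (X ⊗₀ X)
    ∇-coassoc : ∀ {X} → ∇ X ⨾ (∇ X ⊗₁ id) ⨾ α⇒ X X X ≈ ∇ X ⨾ (id ⊗₁ ∇ X)
    ∇-cocomm  : ∀ {X} → ∇ X ⨾ σ X X ≈ ∇ X
    counitˡ   : ∀ {X} → ∇ X ⨾ (! X ⊗₁ id) ⨾ λ⇐ X ≈ id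
    counitʳ   : ∀ {X} → ∇ X ⨾ (id ⊗₁ ! X) ⨾ ρ⇐ X ≈ id
    !-unit : ! unit ≈ id
    ∇-unit : ∇ unit ≈ λ⇒ unit
    !-⊗    : ∀ {X Y} → ! (X ⊗₀ Y) ≈ (! X ⊗₁ ! Y) ⨾ λ⇐ unit
    ∇-⊗    : ∀ {X Y} → ∇ (X ⊗₀ Y) ≈ (∇ X ⊗₁ ∇ Y) ⨾ interchange X Y

module _ {o ℓ e} (C : GSMonoidalCategory o ℓ e) where
  open GSMonoidalCategory C

  IsMarkov : Set (o ⊔ ℓ ⊔ e)
  IsMarkov = ∀ {X Y} (f : X ⇒ Y) → f ⨾ ! Y ≈ ! X

  _·[_]_ : ∀ {Y} → Y ⇒ unit → ∀ (Y′ : Obj) → Y ⇒ unit → Y ⇒ unit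
  _·[_]_ {Y} f _ g = ∇ Y ⨾ (f ⊗₁ g) ⨾ ρ⇐ unit

  IsWeaklyMarkov : Set (o ⊔ ℓ ⊔ e)
  IsWeaklyMarkov = ∀ Y (f : Y ⇒ unit) →
    Σ (Y ⇒ unit) λ g → ((f ·[ Y ] g) ≈ ! Y) × ((g ·[ Y ] f) ≈ ! Y)

  mass : ∀ {X Y} → X ⇒ Y → X ⇒ unit
  mass {X} {Y} f = f ⨾ ! Y

  dom : ∀ {X Y} → X ⇒ Y → X ⇒ X
  dom {X} {Y} f = ∇ X ⨾ (id ⊗₁ (f ⨾ ! Y)) ⨾ ρ⇐ X

  IsMass : Set (o ⊔ ℓ ⊔ e)
  IsMass = ∀ {X Y} (f : X ⇒ Y) → dom f ⨾ mass f ≈ mass f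

{-# OPTIONS --safe #-}
module Submission where

-- The effects X ⇒ I form a monoid under a · b = ∇ ⨾ (a ⊗ b) ⨾ ρ⁻¹ with unit ! X, and
-- dom f ⨾ h = h · mass f.  Hence the mass law says precisely that mass f is idempotent
-- in this monoid; when the monoid is a group, an idempotent is the unit, i.e.
-- f ⨾ ! = !.  Conversely, in a Markov category ! X is the only effect on X.

open import Algebra.Bundles using (Monoid)
open import Data.Product using (_×_; _,_; proj₁; proj₂)
open import Function.Bundles using (_⇔_; mk⇔)
open import Relation.Binary.Bundles using (Setoid)
import Relation.Binary.Reasoning.Setoid as SetoidReasoning

open import Defs

module _ {c ℓ} (M : Monoid c ℓ) where
  open Monoid M
  open import Algebra.Properties.Monoid M using (insertʳ)
  open SetoidReasoning setoid

  idempotent-invertible⇒ε : ∀ {x y} → x ∙ x ≈ x → x ∙ y ≈ ε → x ≈ ε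
  idempotent-invertible⇒ε {x} {y} x∙x≈x x∙y≈ε = begin
    x           ≈⟨ insertʳ x∙y≈ε x ⟩
    (x ∙ x) ∙ y ≈⟨ ∙-congʳ x∙x≈x ⟩
    x ∙ y       ≈⟨ x∙y≈ε ⟩
    ε           ∎

module CategoryProperties {o ℓ e} (𝒞 : Category o ℓ e) where
  open Category 𝒞

  hom-setoid : Obj → Obj → Setoid ℓ e
  hom-setoid A B = record { Carrier = A ⇒ B ; _≈_ = _≈_ ; isEquivalence = equiv }

  module ≈ {A B} = Setoid (hom-setoid A B)
  module HomReasoning {A B} = SetoidReasoning (hom-setoid A B)
  open HomReasoning

  module _ {A B C : Obj} where
    ⨾-congˡ : ∀ {f : A ⇒ B} {g h : B ⇒ C} → g ≈ h → f ⨾ g ≈ f ⨾ h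
    ⨾-congˡ = ⨾-resp-≈ ≈.refl

    ⨾-congʳ : ∀ {f g : A ⇒ B} {h : B ⇒ C} → f ≈ g → f ⨾ h ≈ g ⨾ h
    ⨾-congʳ f≈g = ⨾-resp-≈ f≈g ≈.refl

  module _ {A B C D : Obj} {f : A ⇒ B} {g : B ⇒ C} {k : C ⇒ D} where
    pullˡ : ∀ {h : A ⇒ C} → f ⨾ g ≈ h → f ⨾ g ⨾ k ≈ h ⨾ k
    pullˡ {h} f⨾g≈h = begin
      f ⨾ g ⨾ k   ≈⟨ assoc ⟨
      (f ⨾ g) ⨾ k ≈⟨ ⨾-congʳ f⨾g≈h ⟩
      h ⨾ k       ∎

    extendˡ : ∀ {B′} {f′ : A ⇒ B′} {g′ : B′ ⇒ C} → f ⨾ g ≈ f′ ⨾ g′ → f ⨾ g ⨾ k ≈ f′ ⨾ g′ ⨾ k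
    extendˡ f⨾g≈f′⨾g′ = ≈.trans (pullˡ f⨾g≈f′⨾g′) assoc

  cancelˡ : ∀ {A B C} {i : A ⇒ B} {j : B ⇒ A} {f : A ⇒ C} → i ⨾ j ≈ id → i ⨾ j ⨾ f ≈ f
  cancelˡ i⨾j≈id = ≈.trans (pullˡ i⨾j≈id) identityˡ

  switchʳ : ∀ {A B C} {i : B ⇒ C} {j : C ⇒ B} {f : A ⇒ B} {g : A ⇒ C}
          → i ⨾ j ≈ id → f ⨾ i ≈ g → f ≈ g ⨾ j
  switchʳ {i = i} {j} {f} {g} i⨾j≈id f⨾i≈g = begin
    f         ≈⟨ identityʳ ⟨
    f ⨾ id    ≈⟨ ⨾-congˡ i⨾j≈id ⟨
    f ⨾ i ⨾ j ≈⟨ pullˡ f⨾i≈g ⟩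
    g ⨾ j     ∎

  inverse-unique : ∀ {A B} {g h : B ⇒ A} {f : A ⇒ B} → g ⨾ f ≈ id → f ⨾ h ≈ id → g ≈ h
  inverse-unique g⨾f≈id f⨾h≈id = ≈.trans (switchʳ f⨾h≈id g⨾f≈id) identityˡ

  invert-square : ∀ {A A′ B B′} {i : A ⇒ A′} {i′ : A′ ⇒ A} {j : B ⇒ B′} {j′ : B′ ⇒ B}
                    {f : A ⇒ B} {g : A′ ⇒ B′}
                → i′ ⨾ i ≈ id → j ⨾ j′ ≈ id → f ⨾ j ≈ i ⨾ g → i′ ⨾ f ≈ g ⨾ j′
  invert-square {i = i} {i′} {j′ = j′} {f} {g} i′⨾i≈id j⨾j′≈id square = begin
    i′ ⨾ f            ≈⟨ ⨾-congˡ (switchʳ j⨾j′≈id square) ⟩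
    i′ ⨾ (i ⨾ g) ⨾ j′ ≈⟨ ⨾-congˡ assoc ⟩
    i′ ⨾ i ⨾ g ⨾ j′   ≈⟨ cancelˡ i′⨾i≈id ⟩
    g ⨾ j′            ∎

module GSMonoidalProperties {o ℓ e} (C : GSMonoidalCategory o ℓ e) where
  open GSMonoidalCategory C
  open CategoryProperties category
  open HomReasoning

  ρ⇐-natural : ∀ {X Y} {f : X ⇒ Y} → ρ⇐ X ⨾ f ≈ (f ⊗₁ id) ⨾ ρ⇐ Y
  ρ⇐-natural = invert-square ρ-isoʳ ρ-isoˡ ρ-natural

  λ⇐-natural : ∀ {X Y} {f : X ⇒ Y} → λ⇐ X ⨾ f ≈ (id ⊗₁ f) ⨾ λ⇐ Y
  λ⇐-natural = invert-square λ-isoʳ λ-isoˡ λ-natural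

  α⇐-natural : ∀ {X X′ Y Y′ Z Z′} {f : X ⇒ X′} {g : Y ⇒ Y′} {h : Z ⇒ Z′}
             → α⇐ X Y Z ⨾ ((f ⊗₁ g) ⊗₁ h) ≈ (f ⊗₁ (g ⊗₁ h)) ⨾ α⇐ X′ Y′ Z′
  α⇐-natural = invert-square α-isoʳ α-isoˡ α-natural

  module _ {W X Y Z} {f : W ⇒ X} {g : Y ⇒ Z} where
    id⊗g⨾f⊗id≈f⊗g : (id ⊗₁ g) ⨾ (f ⊗₁ id) ≈ f ⊗₁ g
    id⊗g⨾f⊗id≈f⊗g = ≈.trans (≈.sym ⊗-⨾) (⊗-resp-≈ identityˡ identityʳ)

    f⊗id⨾id⊗g≈f⊗g : (f ⊗₁ id) ⨾ (id ⊗₁ g) ≈ f ⊗₁ g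
    f⊗id⨾id⊗g≈f⊗g = ≈.trans (≈.sym ⊗-⨾) (⊗-resp-≈ identityʳ identityˡ)

  module _ {V W X Y Y′ Z} {f : V ⇒ W} {g : W ⇒ X} {h : X ⇒ Y} {k : Y′ ⇒ Z} where
    ⊗-⨾₃ˡ : (f ⨾ g ⨾ h) ⊗₁ k ≈ (f ⊗₁ id) ⨾ (g ⊗₁ k) ⨾ (h ⊗₁ id)
    ⊗-⨾₃ˡ = begin
      (f ⨾ g ⨾ h) ⊗₁ k                 ≈⟨ ⊗-resp-≈ ≈.refl (≈.trans identityˡ identityʳ) ⟨
      (f ⨾ g ⨾ h) ⊗₁ (id ⨾ k ⨾ id)     ≈⟨ ≈.trans ⊗-⨾ (⨾-congˡ ⊗-⨾) ⟩
      (f ⊗₁ id) ⨾ (g ⊗₁ k) ⨾ (h ⊗₁ id) ∎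

    ⊗-⨾₃ʳ : k ⊗₁ (f ⨾ g ⨾ h) ≈ (id ⊗₁ f) ⨾ (k ⊗₁ g) ⨾ (id ⊗₁ h)
    ⊗-⨾₃ʳ = begin
      k ⊗₁ (f ⨾ g ⨾ h)                 ≈⟨ ⊗-resp-≈ (≈.trans identityˡ identityʳ) ≈.refl ⟨
      (id ⨾ k ⨾ id) ⊗₁ (f ⨾ g ⨾ h)     ≈⟨ ≈.trans ⊗-⨾ (⨾-congˡ ⊗-⨾) ⟩
      (id ⊗₁ f) ⨾ (k ⊗₁ g) ⨾ (id ⊗₁ h) ∎

  ∇-coassoc⇐ : ∀ {X} → ∇ X ⨾ (∇ X ⊗₁ id) ≈ ∇ X ⨾ (id ⊗₁ ∇ X) ⨾ α⇐ X X X
  ∇-coassoc⇐ = ≈.trans (switchʳ α-isoˡ (≈.trans assoc ∇-coassoc)) assoc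

  λ⇒⨾ρ⇐-unit : λ⇒ unit ⨾ ρ⇐ unit ≈ id
  λ⇒⨾ρ⇐-unit = begin
    λ⇒ unit ⨾ ρ⇐ unit                 ≈⟨ ⨾-resp-≈ ∇-unit (≈.trans (⨾-congʳ ⊗-id) identityˡ) ⟨
    ∇ unit ⨾ (id ⊗₁ id) ⨾ ρ⇐ unit     ≈⟨ ⨾-congˡ (⨾-congʳ (⊗-resp-≈ ≈.refl !-unit)) ⟨
    ∇ unit ⨾ (id ⊗₁ ! unit) ⨾ ρ⇐ unit ≈⟨ counitʳ ⟩
    id                                ∎

  λ⇐≈ρ⇐-unit : λ⇐ unit ≈ ρ⇐ unit
  λ⇐≈ρ⇐-unit = inverse-unique λ-isoʳ λ⇒⨾ρ⇐-unit

  α⇐⨾ρ⇐⊗id-unit : α⇐ unit unit unit ⨾ (ρ⇐ unit ⊗₁ id) ≈ id ⊗₁ ρ⇐ unit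
  α⇐⨾ρ⇐⊗id-unit = begin
    α⇐ unit unit unit ⨾ (ρ⇐ unit ⊗₁ id)                       ≈⟨ ⨾-congˡ triangle ⟨
    α⇐ unit unit unit ⨾ α⇒ unit unit unit ⨾ (id ⊗₁ λ⇐ unit)  ≈⟨ cancelˡ α-isoʳ ⟩
    id ⊗₁ λ⇐ unit                                             ≈⟨ ⊗-resp-≈ ≈.refl λ⇐≈ρ⇐-unit ⟩
    id ⊗₁ ρ⇐ unit                                             ∎

  _·_ : ∀ {X} → X ⇒ unit → X ⇒ unit → X ⇒ unit
  _·_ {X} a b = _·[_]_ C a X b

  ·-cong : ∀ {X} {a a′ b b′ : X ⇒ unit} → a ≈ a′ → b ≈ b′ → a · b ≈ a′ · b′
  ·-cong a≈a′ b≈b′ = ⨾-congˡ (⨾-congʳ (⊗-resp-≈ a≈a′ b≈b′))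

  ·-identityˡ : ∀ {X} (a : X ⇒ unit) → ! X · a ≈ a
  ·-identityˡ {X} a = begin
    ∇ X ⨾ (! X ⊗₁ a) ⨾ ρ⇐ unit                ≈⟨ ⨾-congˡ (⨾-resp-≈ f⊗id⨾id⊗g≈f⊗g λ⇐≈ρ⇐-unit) ⟨
    ∇ X ⨾ ((! X ⊗₁ id) ⨾ (id ⊗₁ a)) ⨾ λ⇐ unit ≈⟨ ⨾-congˡ (≈.trans (⨾-congˡ λ⇐-natural) (≈.sym assoc)) ⟨
    ∇ X ⨾ (! X ⊗₁ id) ⨾ λ⇐ X ⨾ a              ≈⟨ ≈.trans (⨾-congˡ (≈.sym assoc)) (pullˡ counitˡ) ⟩
    id ⨾ a                                    ≈⟨ identityˡ ⟩
    a                                         ∎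

  ·-identityʳ : ∀ {X} (a : X ⇒ unit) → a · ! X ≈ a
  ·-identityʳ {X} a = begin
    ∇ X ⨾ (a ⊗₁ ! X) ⨾ ρ⇐ unit              ≈⟨ ⨾-congˡ (pullˡ id⊗g⨾f⊗id≈f⊗g) ⟨
    ∇ X ⨾ (id ⊗₁ ! X) ⨾ (a ⊗₁ id) ⨾ ρ⇐ unit ≈⟨ ⨾-congˡ (⨾-congˡ ρ⇐-natural) ⟨
    ∇ X ⨾ (id ⊗₁ ! X) ⨾ ρ⇐ X ⨾ a            ≈⟨ ≈.trans (⨾-congˡ (≈.sym assoc)) (pullˡ counitʳ) ⟩
    id ⨾ a                                  ≈⟨ identityˡ ⟩
    a                                       ∎

  ·-assoc : ∀ {X} (a b c : X ⇒ unit) → (a · b) · c ≈ a · (b · c)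
  ·-assoc {X} a b c = begin
    ∇ X ⨾ ((∇ X ⨾ (a ⊗₁ b) ⨾ r) ⊗₁ c) ⨾ r
      ≈⟨ ⨾-congˡ (≈.trans (⨾-congʳ ⊗-⨾₃ˡ) (≈.trans assoc (⨾-congˡ assoc))) ⟩
    ∇ X ⨾ (∇ X ⊗₁ id) ⨾ ((a ⊗₁ b) ⊗₁ c) ⨾ (r ⊗₁ id) ⨾ r
      ≈⟨ ≈.trans (extendˡ ∇-coassoc⇐) (⨾-congˡ assoc) ⟩
    ∇ X ⨾ (id ⊗₁ ∇ X) ⨾ α⇐ X X X ⨾ ((a ⊗₁ b) ⊗₁ c) ⨾ (r ⊗₁ id) ⨾ r
      ≈⟨ ⨾-congˡ (⨾-congˡ (extendˡ α⇐-natural)) ⟩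
    ∇ X ⨾ (id ⊗₁ ∇ X) ⨾ (a ⊗₁ (b ⊗₁ c)) ⨾ α⇐ unit unit unit ⨾ (r ⊗₁ id) ⨾ r
      ≈⟨ ⨾-congˡ (⨾-congˡ (⨾-congˡ (pullˡ α⇐⨾ρ⇐⊗id-unit))) ⟩
    ∇ X ⨾ (id ⊗₁ ∇ X) ⨾ (a ⊗₁ (b ⊗₁ c)) ⨾ (id ⊗₁ r) ⨾ r
      ≈⟨ ⨾-congˡ (≈.trans (⨾-congˡ (≈.sym assoc)) (≈.sym assoc)) ⟩
    ∇ X ⨾ ((id ⊗₁ ∇ X) ⨾ (a ⊗₁ (b ⊗₁ c)) ⨾ (id ⊗₁ r)) ⨾ r
      ≈⟨ ⨾-congˡ (⨾-congʳ ⊗-⨾₃ʳ) ⟨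
    ∇ X ⨾ (a ⊗₁ (∇ X ⨾ (b ⊗₁ c) ⨾ r)) ⨾ r
      ∎
    where r = ρ⇐ unit

  effect-monoid : Obj → Monoid ℓ e
  effect-monoid X = record
    { Carrier  = X ⇒ unit
    ; _≈_      = _≈_
    ; _∙_      = _·_
    ; ε        = ! X
    ; isMonoid = record
      { isSemigroup = record
        { isMagma = record { isEquivalence = equiv ; ∙-cong = ·-cong }
        ; assoc   = ·-assoc
        }
      ; identity = ·-identityˡ , ·-identityʳ
      }
    }

  dom-⨾ : ∀ {X Y} (f : X ⇒ Y) (h : X ⇒ unit) → dom C f ⨾ h ≈ h · mass C f
  dom-⨾ {X} f h = begin
    (∇ X ⨾ (id ⊗₁ mass C f) ⨾ ρ⇐ X) ⨾ h          ≈⟨ ≈.trans assoc (⨾-congˡ assoc) ⟩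
    ∇ X ⨾ (id ⊗₁ mass C f) ⨾ ρ⇐ X ⨾ h            ≈⟨ ⨾-congˡ (⨾-congˡ ρ⇐-natural) ⟩
    ∇ X ⨾ (id ⊗₁ mass C f) ⨾ (h ⊗₁ id) ⨾ ρ⇐ unit ≈⟨ ⨾-congˡ (pullˡ id⊗g⨾f⊗id≈f⊗g) ⟩
    ∇ X ⨾ (h ⊗₁ mass C f) ⨾ ρ⇐ unit              ∎

  mass-idempotent : IsMass C → ∀ {X Y} (f : X ⇒ Y) → mass C f · mass C f ≈ mass C f
  mass-idempotent isMass f = ≈.trans (≈.sym (dom-⨾ f (mass C f))) (isMass f)

  Markov⇒unique-effect : IsMarkov C → ∀ {Y} (h : Y ⇒ unit) → h ≈ ! Y
  Markov⇒unique-effect isMarkov {Y} h = begin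
    h          ≈⟨ identityʳ ⟨
    h ⨾ id     ≈⟨ ⨾-congˡ !-unit ⟨
    h ⨾ ! unit ≈⟨ isMarkov h ⟩
    ! Y        ∎

  Markov⇒weaklyMarkov×mass : IsMarkov C → IsWeaklyMarkov C × IsMass C
  Markov⇒weaklyMarkov×mass isMarkov =
    (λ Y f → ! Y , unique _ , unique _) , λ f → ≈.trans (unique _) (≈.sym (unique _))
    where
    unique : ∀ {Y} (h : Y ⇒ unit) → h ≈ ! Y
    unique = Markov⇒unique-effect isMarkov

  weaklyMarkov×mass⇒Markov : IsWeaklyMarkov C × IsMass C → IsMarkov C
  weaklyMarkov×mass⇒Markov (isWeaklyMarkov , isMass) {X} f =
    idempotent-invertible⇒ε (effect-monoid X) (mass-idempotent isMass f)
      (proj₁ (proj₂ (isWeaklyMarkov X (mass C f))))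

proposition5p12 : ∀ {o ℓ e} (C : GSMonoidalCategory o ℓ e) →
    IsMarkov C ⇔ (IsWeaklyMarkov C × IsMass C)
proposition5p12 C = mk⇔ Markov⇒weaklyMarkov×mass weaklyMarkov×mass⇒Markov
  where open GSMonoidalProperties C
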